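{- \[ 0=\sum_{k=0}^\infty \frac{1}{3^{6k}}\left[\frac{3^5}{12k+1}-\frac{5\cdot 3^4}{12k+2}-\frac{3^4}{12k+4}-\frac{3^3}{12k+5}-\frac{2^3\cdot 3^2}{12k+6}-\frac{3^2}{12k+7}-\frac{3^2}{12k+8}-\frac{5}{12k+10}+\frac{1}{12k+11}\right]. \] -}

module Defs where

open import Data.Nat as ℕ using (ℕ; zero; suc)
open import Data.Integer using (ℤ; +_; -_)
open import Data.Rational using (ℚ; _/_; _+_; _*_; 0ℚ; 1ℚ)

-- 1 / 3^(6k) = (1/729)^k
inv729^ : ℕ → ℚ
inv729^ zero    = 1ℚ
inv729^ (suc k) = inv729^ k * ((+ 1) / 729)

-- c / (12k + j + 1), written with suc so the NonZero instance is found
frac : ℤ → ℕ → ℕ → ℚ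
frac c k j = c / suc (12 ℕ.* k ℕ.+ j)

term : ℕ → ℚ
term k = inv729^ k *
  ( frac (+ 243) k 0
  + frac (- (+ 405)) k 1
  + frac (- (+ 81)) k 3
  + frac (- (+ 27)) k 4
  + frac (- (+ 72)) k 5
  + frac (- (+ 9)) k 6
  + frac (- (+ 9)) k 7
  + frac (- (+ 5)) k 9
  + frac (+ 1) k 10 )

partialSum : ℕ → ℚ
partialSum zero    = 0ℚ
partialSum (suc n) = partialSum n + term n

-- Since 1/(12k + j + 1) = ∫₀¹ t^(12k + j) dt, the series is ∫₀¹ P(t) / (1 - t¹²/729) dt for the
-- polynomial P with the coefficients of the bracket, and P / (1 - t¹²/729) = 243 (N′/N - D′/D) for
-- N = (3 - t²)² and D = (t² - 3t + 3)(t² + 3). As N(0) = D(0) = 9 and N(1) = D(1) = 4, the integral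
-- 243 [log (N/D)]₀¹ vanishes.
-- To stay within ℚ, write N = 9(1 - a) and D = 9(1 - b), so that 0 ≤ a, b ≤ 5/9 on [0, 1] and
-- log (N/D) = log (1 - a) - log (1 - b) has a geometrically convergent power series. The polynomial
-- Gₙ = (first n terms, integrated from 0 to t) - 243 (that series truncated after 2n terms) has
-- Gₙ(1) - Gₙ(0) equal to the n-th partial sum and Gₙ′ · N · D = 243 (N′D (a²ⁿ - wⁿ) - N D′ (b²ⁿ - wⁿ))
-- with w = t¹²/729, so |Gₙ′| ≤ K 2⁻ⁿ on [0, 1]. A mean value inequality on [0, 1], proved on finer and
-- finer grids from a uniform quadratic Taylor remainder, bounds the n-th partial sum by K 2⁻ⁿ.

module Submission where

open import Data.Nat as ℕ using (ℕ; zero; suc; _≥_)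
import Data.Nat.Properties as ℕ
open import Data.Integer as ℤ using (ℤ; +_; -[1+_])
import Data.Integer.Properties as ℤ
open import Data.Fin using (zero)
open import Data.Vec using ([]; _∷_)
open import Data.List using (List; []; _∷_; foldl; drop)
open import Data.Product using (∃-syntax; _,_; _×_; proj₁; proj₂)
open import Data.Empty using (⊥-elim)
open import Data.Rational hiding (_≥_)
open import Data.Rational.Properties
import Data.Rational.Unnormalised as ℚᵘ
import Data.Rational.Unnormalised.Properties as ℚᵘ
open import Data.Rational.Solver using (module +-*-Solver)
open +-*-Solver
open import Algebra.Bundles using (CommutativeRing)
open import Algebra.Properties.CommutativeSemiring.Exp
  (CommutativeRing.commutativeSemiring +-*-commutativeRing) using (_^_; ^-homo-*; ^-assocʳ; ^-distrib-*)
open import Relation.Binary.PropositionalEquality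
open import Relation.Nullary.Decidable using (yes; no)
open import Defs

private variable
  p q r s : ℚ

0≤1 : 0ℚ ≤ 1ℚ
0≤1 = ≤ᵇ⇒≤ _

*-mono-≤-nonNeg : 0ℚ ≤ p → 0ℚ ≤ r → p ≤ q → r ≤ s → p * r ≤ q * s
*-mono-≤-nonNeg {r = r} {q = q} 0≤p 0≤r p≤q r≤s = ≤-trans
  (*-monoʳ-≤-nonNeg r {{nonNegative 0≤r}} p≤q)
  (*-monoˡ-≤-nonNeg q {{nonNegative (≤-trans 0≤p p≤q)}} r≤s)

0≤p*q : 0ℚ ≤ p → 0ℚ ≤ q → 0ℚ ≤ p * q
0≤p*q = *-mono-≤-nonNeg ≤-refl ≤-refl

∣p*q∣≤r*s : ∣ p ∣ ≤ r → ∣ q ∣ ≤ s → ∣ p * q ∣ ≤ r * s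
∣p*q∣≤r*s {p = p} {q = q} ∣p∣≤r ∣q∣≤s = subst (_≤ _) (sym (∣p*q∣≡∣p∣*∣q∣ p q))
  (*-mono-≤-nonNeg (0≤∣p∣ p) (0≤∣p∣ q) ∣p∣≤r ∣q∣≤s)

∣p+q∣≤r+s : ∣ p ∣ ≤ r → ∣ q ∣ ≤ s → ∣ p + q ∣ ≤ r + s
∣p+q∣≤r+s {p = p} {q = q} ∣p∣≤r ∣q∣≤s = ≤-trans (∣p+q∣≤∣p∣+∣q∣ p q) (+-mono-≤ ∣p∣≤r ∣q∣≤s)

∣p-q∣≤r+s : ∣ p ∣ ≤ r → ∣ q ∣ ≤ s → ∣ p - q ∣ ≤ r + s
∣p-q∣≤r+s {p = p} {q = q} ∣p∣≤r ∣q∣≤s = ≤-trans (∣p-q∣≤∣p∣+∣q∣ p q) (+-mono-≤ ∣p∣≤r ∣q∣≤s)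

p≤q⇒0≤q-p : p ≤ q → 0ℚ ≤ q - p
p≤q⇒0≤q-p {p} {q} p≤q = subst (_≤ q - p) (+-inverseʳ p) (+-monoˡ-≤ (- p) p≤q)

0≤q-p⇒p≤q : 0ℚ ≤ q - p → p ≤ q
0≤q-p⇒p≤q {q = q} {p = p} 0≤q-p = subst₂ _≤_ (+-identityʳ p)
  (solve 2 (λ p q → p :+ (q :- p) := q) refl p q) (+-monoʳ-≤ p 0≤q-p)

0≤p⇒q-p≤q : 0ℚ ≤ p → q - p ≤ q
0≤p⇒q-p≤q {q = q} 0≤p = subst (q - _ ≤_) (+-identityʳ q) (+-monoʳ-≤ q (neg-antimono-≤ 0≤p))

∣p∣≤∣p*q*r∣ : 1ℚ ≤ q → 1ℚ ≤ r → ∣ p ∣ ≤ ∣ p * q * r ∣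
∣p∣≤∣p*q*r∣ {q} {r} {p} 1≤q 1≤r = begin
  ∣ p ∣                  ≡⟨ solve 1 (λ x → x := x :* con 1ℚ :* con 1ℚ) refl ∣ p ∣ ⟩
  ∣ p ∣ * 1ℚ * 1ℚ        ≤⟨ *-mono-≤-nonNeg (0≤p*q (0≤∣p∣ p) 0≤1) 0≤1
                              (*-mono-≤-nonNeg (0≤∣p∣ p) 0≤1 ≤-refl (≤-trans 1≤q (≤-reflexive (sym ∣q∣≡q))))
                              (≤-trans 1≤r (≤-reflexive (sym ∣r∣≡r))) ⟩
  ∣ p ∣ * ∣ q ∣ * ∣ r ∣  ≡⟨ cong (_* ∣ r ∣) (∣p*q∣≡∣p∣*∣q∣ p q) ⟨
  ∣ p * q ∣ * ∣ r ∣      ≡⟨ ∣p*q∣≡∣p∣*∣q∣ (p * q) r ⟨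
  ∣ p * q * r ∣          ∎
  where
  open ≤-Reasoning
  ∣q∣≡q = 0≤p⇒∣p∣≡p (≤-trans 0≤1 1≤q)
  ∣r∣≡r = 0≤p⇒∣p∣≡p (≤-trans 0≤1 1≤r)

fromℕ : ℕ → ℚ
fromℕ zero    = 0ℚ
fromℕ (suc n) = 1ℚ + fromℕ n

fromℕ-nonNeg : ∀ n → 0ℚ ≤ fromℕ n
fromℕ-nonNeg zero    = ≤-refl
fromℕ-nonNeg (suc n) = +-mono-≤ 0≤1 (fromℕ-nonNeg n)

fromℕ-mono-≤ : ∀ {m n} → m ℕ.≤ n → fromℕ m ≤ fromℕ n
fromℕ-mono-≤ {n = n} ℕ.z≤n = fromℕ-nonNeg n
fromℕ-mono-≤ (ℕ.s≤s m≤n)   = +-monoʳ-≤ 1ℚ (fromℕ-mono-≤ m≤n)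

toℚᵘ-fromℕ : ∀ n → toℚᵘ (fromℕ n) ℚᵘ.≃ ℚᵘ.mkℚᵘ (+ n) 0
toℚᵘ-fromℕ zero    = ℚᵘ.*≡* refl
toℚᵘ-fromℕ (suc n) = ℚᵘ.≃-trans (toℚᵘ-homo-+ 1ℚ (fromℕ n))
  (ℚᵘ.≃-trans (ℚᵘ.+-congʳ (toℚᵘ 1ℚ) (toℚᵘ-fromℕ n))
    (ℚᵘ.*≡* (cong (λ z → (+ 1 ℤ.+ z) ℤ.* + 1) (ℤ.*-identityʳ (+ n)))))

c/[1+n]*[1+n]≡c : ∀ c n → c / suc n * fromℕ (suc n) ≡ c / 1
c/[1+n]*[1+n]≡c c n = toℚᵘ-injective (ℚᵘ.≃-trans (toℚᵘ-homo-* (c / suc n) (fromℕ (suc n)))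
  (ℚᵘ.≃-trans (ℚᵘ.*-cong (toℚᵘ-fromℚᵘ (ℚᵘ.mkℚᵘ c n)) (toℚᵘ-fromℕ (suc n)))
  (ℚᵘ.≃-trans (ℚᵘ.*≡* cross) (ℚᵘ.≃-sym (toℚᵘ-fromℚᵘ (ℚᵘ.mkℚᵘ c 0))))))
  where
  cross : c ℤ.* + suc n ℤ.* + 1 ≡ c ℤ.* + (suc n ℕ.* 1)
  cross = trans (ℤ.*-identityʳ _) (cong (λ m → c ℤ.* + m) (sym (ℕ.*-identityʳ (suc n))))

archimedean : ∀ p → ∃[ n ] p < fromℕ n
archimedean p@(mkℚ -[1+ _ ] _ _) = 0 , negative⁻¹ p
archimedean (mkℚ (+ k) d _) = suc k ,
  toℚᵘ-cancel-< (ℚᵘ.<-respʳ-≃ (ℚᵘ.≃-sym (toℚᵘ-fromℕ (suc k))) (ℚᵘ.*<* k*1<[1+k]*[1+d]))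
  where
  k*1<[1+k]*[1+d] : + k ℤ.* + 1 ℤ.< + suc k ℤ.* + suc d
  k*1<[1+k]*[1+d] rewrite ℤ.*-identityʳ (+ k) | sym (ℤ.pos-* (suc k) (suc d)) =
    ℤ.+<+ (ℕ.<-≤-trans (ℕ.n<1+n k) (ℕ.m≤m*n (suc k) (suc d)))

1/[1+_] : ℕ → ℚ
1/[1+ n ] = + 1 / suc n

1/[1+n]-pos : ∀ n → 0ℚ < 1/[1+ n ]
1/[1+n]-pos n = positive⁻¹ _ {{normalize-pos 1 (suc n)}}

[1+n]*1/[1+n]≡1 : ∀ n → fromℕ (suc n) * 1/[1+ n ] ≡ 1ℚ
[1+n]*1/[1+n]≡1 n = trans (*-comm (fromℕ (suc n)) 1/[1+ n ]) (c/[1+n]*[1+n]≡c (+ 1) n)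

∑ : ℕ → (ℕ → ℚ) → ℚ
∑ zero    f = 0ℚ
∑ (suc n) f = ∑ n f + f n

infix 5 ∑
syntax ∑ n (λ k → e) = ∑[ k < n ] e

∑-cong : ∀ {f g} n → (∀ k → f k ≡ g k) → ∑ n f ≡ ∑ n g
∑-cong zero    f≗g = refl
∑-cong (suc n) f≗g = cong₂ _+_ (∑-cong n f≗g) (f≗g n)

∑-zero : ∀ {f} n → (∀ k → f k ≡ 0ℚ) → ∑ n f ≡ 0ℚ
∑-zero zero    f≗0 = refl
∑-zero (suc n) f≗0 = cong₂ _+_ (∑-zero n f≗0) (f≗0 n)

∑-*-distribˡ : ∀ c f n → c * ∑ n f ≡ ∑[ k < n ] c * f k
∑-*-distribˡ c f zero    = *-zeroʳ c
∑-*-distribˡ c f (suc n) = trans (*-distribˡ-+ c (∑ n f) (f n)) (cong (_+ c * f n) (∑-*-distribˡ c f n))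

∑-*-distribʳ : ∀ c f n → ∑ n f * c ≡ ∑[ k < n ] f k * c
∑-*-distribʳ c f n = trans (*-comm (∑ n f) c) (trans (∑-*-distribˡ c f n) (∑-cong n (λ k → *-comm c (f k))))

geometric : ∀ r n → (1ℚ - r) * (∑[ k < n ] r ^ k) ≡ 1ℚ - r ^ n
geometric r zero    = trans (*-zeroʳ (1ℚ - r)) (sym (+-inverseʳ 1ℚ))
geometric r (suc n) = begin
  (1ℚ - r) * ((∑[ k < n ] r ^ k) + r ^ n)           ≡⟨ *-distribˡ-+ (1ℚ - r) _ (r ^ n) ⟩
  (1ℚ - r) * (∑[ k < n ] r ^ k) + (1ℚ - r) * r ^ n  ≡⟨ cong (_+ (1ℚ - r) * r ^ n) (geometric r n) ⟩
  1ℚ - r ^ n + (1ℚ - r) * r ^ n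
    ≡⟨ solve 2 (λ r rⁿ → con 1ℚ :- rⁿ :+ (con 1ℚ :- r) :* rⁿ := con 1ℚ :- r :* rⁿ) refl r (r ^ n) ⟩
  1ℚ - r ^ suc n                                    ∎
  where open ≡-Reasoning

∑ᴸ : {A : Set} → (A → ℚ) → List A → ℚ
∑ᴸ g []       = 0ℚ
∑ᴸ g (a ∷ as) = g a + ∑ᴸ g as

module _ {A : Set} where

  ∑ᴸ-cong : ∀ {f g : A → ℚ} as → (∀ a → f a ≡ g a) → ∑ᴸ f as ≡ ∑ᴸ g as
  ∑ᴸ-cong []       f≗g = refl
  ∑ᴸ-cong (a ∷ as) f≗g = cong₂ _+_ (f≗g a) (∑ᴸ-cong as f≗g)

  ∑ᴸ-zero : ∀ {f : A → ℚ} as → (∀ a → f a ≡ 0ℚ) → ∑ᴸ f as ≡ 0ℚ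
  ∑ᴸ-zero []       f≗0 = refl
  ∑ᴸ-zero (a ∷ as) f≗0 = trans (cong₂ _+_ (f≗0 a) (∑ᴸ-zero as f≗0)) (+-identityʳ 0ℚ)

  ∑ᴸ-*-distribˡ : ∀ c (f : A → ℚ) as → c * ∑ᴸ f as ≡ ∑ᴸ (λ a → c * f a) as
  ∑ᴸ-*-distribˡ c f []       = *-zeroʳ c
  ∑ᴸ-*-distribˡ c f (a ∷ as) = trans (*-distribˡ-+ c (f a) (∑ᴸ f as)) (cong (_+_ (c * f a)) (∑ᴸ-*-distribˡ c f as))

  foldl-+ : ∀ (f : A → ℚ) a as → foldl (λ s b → s + f b) (f a) as ≡ ∑ᴸ f (a ∷ as)
  foldl-+ f a as = go (f a) as
    where
    go : ∀ p as → foldl (λ s b → s + f b) p as ≡ p + ∑ᴸ f as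
    go p []       = sym (+-identityʳ p)
    go p (b ∷ as) = trans (go (p + f b) as) (+-assoc p (f b) (∑ᴸ f as))

1^n≡1 : ∀ n → 1ℚ ^ n ≡ 1ℚ
1^n≡1 zero    = refl
1^n≡1 (suc n) = trans (*-identityˡ (1ℚ ^ n)) (1^n≡1 n)

^-nonNeg : ∀ n → 0ℚ ≤ p → 0ℚ ≤ p ^ n
^-nonNeg zero    0≤p = 0≤1
^-nonNeg (suc n) 0≤p = 0≤p*q 0≤p (^-nonNeg n 0≤p)

^-mono-≤ : ∀ n → 0ℚ ≤ p → p ≤ q → p ^ n ≤ q ^ n
^-mono-≤ zero    0≤p p≤q = ≤-refl
^-mono-≤ (suc n) 0≤p p≤q = *-mono-≤-nonNeg 0≤p (^-nonNeg n 0≤p) p≤q (^-mono-≤ n 0≤p p≤q)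

∣p^n∣≤½^n : ∀ n → 0ℚ ≤ p → p ≤ ½ → ∣ p ^ n ∣ ≤ ½ ^ n
∣p^n∣≤½^n n 0≤p p≤½ = ≤-trans (≤-reflexive (0≤p⇒∣p∣≡p (^-nonNeg n 0≤p))) (^-mono-≤ n 0≤p p≤½)

∣p^[n+n]∣≤½^n : ∀ n → 0ℚ ≤ p → p ≤ + 5 / 9 → ∣ p ^ (n ℕ.+ n) ∣ ≤ ½ ^ n
∣p^[n+n]∣≤½^n {p} n 0≤p p≤5/9 = subst (λ v → ∣ v ∣ ≤ ½ ^ n) [p*p]ⁿ≡p^[n+n]
  (∣p^n∣≤½^n n (0≤p*q 0≤p 0≤p) (≤-trans (*-mono-≤-nonNeg 0≤p 0≤p p≤5/9 p≤5/9) (≤ᵇ⇒≤ _)))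
  where
  [p*p]ⁿ≡p^[n+n] : (p * p) ^ n ≡ p ^ (n ℕ.+ n)
  [p*p]ⁿ≡p^[n+n] = trans (^-distrib-* p p n) (sym (^-homo-* p n n))

0≤½ : 0ℚ ≤ ½
0≤½ = ≤ᵇ⇒≤ _

½^n*[1+n]≤1 : ∀ n → ½ ^ n * fromℕ (suc n) ≤ 1ℚ
½^n*[1+n]≤1 zero    = ≤-refl
½^n*[1+n]≤1 (suc n) = ≤-trans (0≤q-p⇒p≤q (subst (0ℚ ≤_) difference
  (0≤p*q 0≤½ (0≤p*q (^-nonNeg n 0≤½) (fromℕ-nonNeg n))))) (½^n*[1+n]≤1 n)
  where
  difference : ½ * (½ ^ n * fromℕ n) ≡ ½ ^ n * fromℕ (suc n) - ½ ^ suc n * fromℕ (suc (suc n))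
  difference = solve 2 (λ r k → con ½ :* (r :* k) := r :* (con 1ℚ :+ k) :- con ½ :* r :* (con 1ℚ :+ (con 1ℚ :+ k)))
                 refl (½ ^ n) (fromℕ n)

½^n≤1/[1+n] : ∀ n → ½ ^ n ≤ 1/[1+ n ]
½^n≤1/[1+n] n = begin
  ½ ^ n                                   ≡⟨ *-identityʳ (½ ^ n) ⟨
  ½ ^ n * 1ℚ                              ≡⟨ cong (½ ^ n *_) ([1+n]*1/[1+n]≡1 n) ⟨
  ½ ^ n * (fromℕ (suc n) * 1/[1+ n ])     ≡⟨ *-assoc (½ ^ n) (fromℕ (suc n)) 1/[1+ n ] ⟨
  ½ ^ n * fromℕ (suc n) * 1/[1+ n ]       ≤⟨ *-mono-≤-nonNeg (0≤p*q (^-nonNeg n 0≤½) (fromℕ-nonNeg (suc n)))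
                                               (<⇒≤ (1/[1+n]-pos n)) (½^n*[1+n]≤1 n) ≤-refl ⟩
  1ℚ * 1/[1+ n ]                          ≡⟨ *-identityˡ 1/[1+ n ] ⟩
  1/[1+ n ]                               ∎
  where open ≤-Reasoning

-- Differentiability on [0, 1] with a uniform quadratic Taylor remainder, the form in which
-- C¹ with Lipschitz derivative makes sense over ℚ; bounding f as well as f′ makes the
-- class closed under products.
record Differentiable (f f′ : ℚ → ℚ) : Set where
  field
    M M′ C : ℚ
    bound  : ∀ {x} → 0ℚ ≤ x → x ≤ 1ℚ → ∣ f x ∣ ≤ M
    bound′ : ∀ {x} → 0ℚ ≤ x → x ≤ 1ℚ → ∣ f′ x ∣ ≤ M′
    taylor : ∀ {x y} → 0ℚ ≤ x → x ≤ y → y ≤ 1ℚ →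
             ∣ f y - f x - (y - x) * f′ x ∣ ≤ C * ((y - x) * (y - x))

  M-nonNeg : 0ℚ ≤ M
  M-nonNeg = ≤-trans (0≤∣p∣ _) (bound ≤-refl 0≤1)

  M′-nonNeg : 0ℚ ≤ M′
  M′-nonNeg = ≤-trans (0≤∣p∣ _) (bound′ ≤-refl 0≤1)

  C-nonNeg : 0ℚ ≤ C
  C-nonNeg = ≤-trans (0≤∣p∣ _) (subst (_ ≤_) (*-identityʳ C) (taylor ≤-refl 0≤1 ≤-refl))

  lipschitz : ∀ {x y} → 0ℚ ≤ x → x ≤ y → y ≤ 1ℚ → ∣ f y - f x ∣ ≤ (M′ + C) * (y - x)
  lipschitz {x} {y} 0≤x x≤y y≤1 = begin
    ∣ f y - f x ∣                               ≡⟨ cong ∣_∣ split ⟩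
    ∣ f y - f x - d * f′ x + d * f′ x ∣          ≤⟨ ∣p+q∣≤r+s (taylor 0≤x x≤y y≤1)
                                                      (∣p*q∣≤r*s ∣d∣≤d (bound′ 0≤x (≤-trans x≤y y≤1))) ⟩
    C * (d * d) + d * M′                        ≤⟨ +-monoˡ-≤ (d * M′) (*-mono-≤-nonNeg C-nonNeg (0≤p*q 0≤d 0≤d) ≤-refl d*d≤d) ⟩
    C * d + d * M′                              ≡⟨ solve 3 (λ C d M′ → C :* d :+ d :* M′ := (M′ :+ C) :* d) refl C d M′ ⟩
    (M′ + C) * d                                ∎
    where
    open ≤-Reasoning
    d = y - x
    0≤d = p≤q⇒0≤q-p x≤y
    ∣d∣≤d : ∣ d ∣ ≤ d
    ∣d∣≤d = ≤-reflexive (0≤p⇒∣p∣≡p 0≤d)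
    d*d≤d : d * d ≤ d
    d*d≤d = subst (d * d ≤_) (*-identityʳ d) (*-monoˡ-≤-nonNeg d {{nonNegative 0≤d}} (≤-trans (0≤p⇒q-p≤q 0≤x) y≤1))
    split : f y - f x ≡ f y - f x - d * f′ x + d * f′ x
    split = solve 4 (λ fy fx d f′x → fy :- fx := fy :- fx :- d :* f′x :+ d :* f′x) refl (f y) (f x) d (f′ x)

open Differentiable
private variable
  f f′ g g′ : ℚ → ℚ

zero-remainder : ∀ {e} d → e ≡ 0ℚ → ∣ e ∣ ≤ 0ℚ * d
zero-remainder d refl = ≤-reflexive (sym (*-zeroˡ d))

const-diff : ∀ c → Differentiable (λ _ → c) (λ _ → 0ℚ)
const-diff c = record
  { M = ∣ c ∣ ; M′ = 0ℚ ; C = 0ℚ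
  ; bound  = λ _ _ → ≤-refl
  ; bound′ = λ _ _ → ≤-refl
  ; taylor = λ {x} {y} _ _ _ → zero-remainder ((y - x) * (y - x))
      (solve 3 (λ c x y → c :- c :- (y :- x) :* con 0ℚ := con 0ℚ) refl c x y)
  }

id-diff : Differentiable (λ x → x) (λ _ → 1ℚ)
id-diff = record
  { M = 1ℚ ; M′ = 1ℚ ; C = 0ℚ
  ; bound  = λ 0≤x x≤1 → ≤-trans (≤-reflexive (0≤p⇒∣p∣≡p 0≤x)) x≤1
  ; bound′ = λ _ _ → ≤-refl
  ; taylor = λ {x} {y} _ _ _ → zero-remainder ((y - x) * (y - x))
      (solve 2 (λ x y → y :- x :- (y :- x) :* con 1ℚ := con 0ℚ) refl x y)
  }

diff-cong : Differentiable f f′ → (∀ x → f x ≡ g x) → (∀ x → f′ x ≡ g′ x) → Differentiable g g′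
diff-cong {f} {f′} {g} {g′} Df f≗g f′≗g′ = record
  { M = M Df ; M′ = M′ Df ; C = C Df
  ; bound  = λ {x} 0≤x x≤1 → subst (λ v → ∣ v ∣ ≤ M Df) (f≗g x) (bound Df 0≤x x≤1)
  ; bound′ = λ {x} 0≤x x≤1 → subst (λ v → ∣ v ∣ ≤ M′ Df) (f′≗g′ x) (bound′ Df 0≤x x≤1)
  ; taylor = λ {x} {y} 0≤x x≤y y≤1 → subst (λ v → ∣ v ∣ ≤ _) (remainder-cong x y) (taylor Df 0≤x x≤y y≤1)
  }
  where
  remainder-cong : ∀ x y → f y - f x - (y - x) * f′ x ≡ g y - g x - (y - x) * g′ x
  remainder-cong x y rewrite f≗g x | f≗g y | f′≗g′ x = refl

+-diff : Differentiable f f′ → Differentiable g g′ →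
         Differentiable (λ x → f x + g x) (λ x → f′ x + g′ x)
+-diff {f} {f′} {g} {g′} Df Dg = record
  { M = M Df + M Dg ; M′ = M′ Df + M′ Dg ; C = C Df + C Dg
  ; bound  = λ 0≤x x≤1 → ∣p+q∣≤r+s (bound Df 0≤x x≤1) (bound Dg 0≤x x≤1)
  ; bound′ = λ 0≤x x≤1 → ∣p+q∣≤r+s (bound′ Df 0≤x x≤1) (bound′ Dg 0≤x x≤1)
  ; taylor = λ {x} {y} 0≤x x≤y y≤1 → subst₂ (λ u v → ∣ u ∣ ≤ v) (split x y) (sym (*-distribʳ-+ _ (C Df) (C Dg)))
      (∣p+q∣≤r+s (taylor Df 0≤x x≤y y≤1) (taylor Dg 0≤x x≤y y≤1))
  }
  where
  split : ∀ x y → f y - f x - (y - x) * f′ x + (g y - g x - (y - x) * g′ x)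
                ≡ f y + g y - (f x + g x) - (y - x) * (f′ x + g′ x)
  split x y = solve 8 (λ fy gy fx gx f′x g′x x y →
      fy :- fx :- (y :- x) :* f′x :+ (gy :- gx :- (y :- x) :* g′x)
      := fy :+ gy :- (fx :+ gx) :- (y :- x) :* (f′x :+ g′x))
    refl (f y) (g y) (f x) (g x) (f′ x) (g′ x) x y

*-diff : Differentiable f f′ → Differentiable g g′ →
         Differentiable (λ x → f x * g x) (λ x → f′ x * g x + f x * g′ x)
*-diff {f} {f′} {g} {g′} Df Dg = record
  { M = M Df * M Dg ; M′ = M′ Df * M Dg + M Df * M′ Dg
  ; C = C Df * M Dg + M′ Df * (M′ Dg + C Dg) + M Df * C Dg
  ; bound  = λ 0≤x x≤1 → ∣p*q∣≤r*s (bound Df 0≤x x≤1) (bound Dg 0≤x x≤1)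
  ; bound′ = λ 0≤x x≤1 → ∣p+q∣≤r+s (∣p*q∣≤r*s (bound′ Df 0≤x x≤1) (bound Dg 0≤x x≤1))
                                   (∣p*q∣≤r*s (bound Df 0≤x x≤1) (bound′ Dg 0≤x x≤1))
  ; taylor = remainder
  }
  where
  remainder : ∀ {x y} → 0ℚ ≤ x → x ≤ y → y ≤ 1ℚ →
    ∣ f y * g y - f x * g x - (y - x) * (f′ x * g x + f x * g′ x) ∣
      ≤ (C Df * M Dg + M′ Df * (M′ Dg + C Dg) + M Df * C Dg) * ((y - x) * (y - x))
  remainder {x} {y} 0≤x x≤y y≤1 = subst₂ (λ u v → ∣ u ∣ ≤ v) split collect
    (∣p+q∣≤r+s (∣p+q∣≤r+s
      (∣p*q∣≤r*s (taylor Df 0≤x x≤y y≤1) (bound Dg (≤-trans 0≤x x≤y) y≤1))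
      (∣p*q∣≤r*s (∣p*q∣≤r*s (≤-reflexive (0≤p⇒∣p∣≡p (p≤q⇒0≤q-p x≤y))) (bound′ Df 0≤x x≤1))
                 (lipschitz Dg 0≤x x≤y y≤1)))
      (∣p*q∣≤r*s (bound Df 0≤x x≤1) (taylor Dg 0≤x x≤y y≤1)))
    where
    x≤1 = ≤-trans x≤y y≤1
    split : (f y - f x - (y - x) * f′ x) * g y + (y - x) * f′ x * (g y - g x) + f x * (g y - g x - (y - x) * g′ x)
          ≡ f y * g y - f x * g x - (y - x) * (f′ x * g x + f x * g′ x)
    split = solve 8 (λ fy fx f′x gy gx g′x x y →
        (fy :- fx :- (y :- x) :* f′x) :* gy :+ (y :- x) :* f′x :* (gy :- gx) :+ fx :* (gy :- gx :- (y :- x) :* g′x)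
        := fy :* gy :- fx :* gx :- (y :- x) :* (f′x :* gx :+ fx :* g′x))
      refl (f y) (f x) (f′ x) (g y) (g x) (g′ x) x y
    collect : C Df * ((y - x) * (y - x)) * M Dg + (y - x) * M′ Df * ((M′ Dg + C Dg) * (y - x)) + M Df * (C Dg * ((y - x) * (y - x)))
            ≡ (C Df * M Dg + M′ Df * (M′ Dg + C Dg) + M Df * C Dg) * ((y - x) * (y - x))
    collect = solve 7 (λ Cf Mg M′f M′g Cg Mf d →
        Cf :* (d :* d) :* Mg :+ d :* M′f :* ((M′g :+ Cg) :* d) :+ Mf :* (Cg :* (d :* d))
        := (Cf :* Mg :+ M′f :* (M′g :+ Cg) :+ Mf :* Cg) :* (d :* d))
      refl (C Df) (M Dg) (M′ Df) (M′ Dg) (C Dg) (M Df) (y - x)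

scale-diff : ∀ c → Differentiable f f′ → Differentiable (λ x → c * f x) (λ x → c * f′ x)
scale-diff {f} {f′} c Df = diff-cong (*-diff (const-diff c) Df) (λ _ → refl)
  (λ x → solve 3 (λ c fx f′x → con 0ℚ :* fx :+ c :* f′x := c :* f′x) refl c (f x) (f′ x))

-‿diff : Differentiable f f′ → Differentiable (λ x → - f x) (λ x → - f′ x)
-‿diff {f} {f′} Df = diff-cong (scale-diff (- 1ℚ) Df)
  (λ x → solve 1 (λ u → con (- 1ℚ) :* u := :- u) refl (f x))
  (λ x → solve 1 (λ u → con (- 1ℚ) :* u := :- u) refl (f′ x))

^-diff : Differentiable f f′ → ∀ n →
         Differentiable (λ x → f x ^ suc n) (λ x → fromℕ (suc n) * f x ^ n * f′ x)
^-diff {f} {f′} Df zero    = diff-cong Df (λ x → sym (*-identityʳ (f x)))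
  (λ x → solve 1 (λ u → u := (con 1ℚ :+ con 0ℚ) :* con 1ℚ :* u) refl (f′ x))
^-diff {f} {f′} Df (suc n) = diff-cong (*-diff Df (^-diff Df n)) (λ _ → refl)
  (λ x → solve 4 (λ u uⁿ k u′ → u′ :* (u :* uⁿ) :+ u :* (k :* uⁿ :* u′) := (con 1ℚ :+ k) :* (u :* uⁿ) :* u′)
                 refl (f x) (f x ^ n) (fromℕ (suc n)) (f′ x))

∑-diff : ∀ {F F′ : ℕ → ℚ → ℚ} → (∀ k → Differentiable (F k) (F′ k)) →
         ∀ n → Differentiable (λ x → ∑[ k < n ] F k x) (λ x → ∑[ k < n ] F′ k x)
∑-diff DF zero    = const-diff 0ℚ
∑-diff DF (suc n) = +-diff (∑-diff DF n) (DF n)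

∑ᴸ-diff : ∀ {A : Set} {F F′ : A → ℚ → ℚ} → (∀ a → Differentiable (F a) (F′ a)) →
          ∀ as → Differentiable (λ x → ∑ᴸ (λ a → F a x) as) (λ x → ∑ᴸ (λ a → F′ a x) as)
∑ᴸ-diff DF []       = const-diff 0ℚ
∑ᴸ-diff DF (a ∷ as) = +-diff (DF a) (∑ᴸ-diff DF as)

eventually-*1/[1+n]< : ∀ {δ} → 0ℚ < δ → ∀ r → ∃[ N ] (∀ n → n ≥ N → r * 1/[1+ n ] < δ)
eventually-*1/[1+n]< {δ} 0<δ r = N , λ n n≥N → begin-strict
  r * 1/[1+ n ]                         ≡⟨ cong (_* 1/[1+ n ]) r≡r/δ*δ ⟩
  r * 1/ δ * δ * 1/[1+ n ]              <⟨ *-monoˡ-<-pos 1/[1+ n ] {{positive (1/[1+n]-pos n)}}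
                                             (*-monoˡ-<-pos δ {{positive 0<δ}} r/δ<N) ⟩
  fromℕ N * δ * 1/[1+ n ]               ≤⟨ *-monoʳ-≤-nonNeg 1/[1+ n ] {{nonNegative (<⇒≤ (1/[1+n]-pos n))}}
                                             (*-monoʳ-≤-nonNeg δ {{nonNegative (<⇒≤ 0<δ)}}
                                               (fromℕ-mono-≤ (ℕ.≤-trans n≥N (ℕ.n≤1+n n)))) ⟩
  fromℕ (suc n) * δ * 1/[1+ n ]         ≡⟨ solve 3 (λ k δ h → k :* δ :* h := δ :* (k :* h))
                                               refl (fromℕ (suc n)) δ 1/[1+ n ] ⟩
  δ * (fromℕ (suc n) * 1/[1+ n ])       ≡⟨ cong (δ *_) ([1+n]*1/[1+n]≡1 n) ⟩
  δ * 1ℚ                                ≡⟨ *-identityʳ δ ⟩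
  δ                                     ∎
  where
  open ≤-Reasoning
  instance _ = >-nonZero 0<δ
  N = proj₁ (archimedean (r * 1/ δ))
  r/δ<N = proj₂ (archimedean (r * 1/ δ))
  r≡r/δ*δ : r ≡ r * 1/ δ * δ
  r≡r/δ*δ = sym (trans (*-assoc r (1/ δ) δ) (trans (cong (r *_) (*-inverseˡ δ)) (*-identityʳ r)))

≤-from-≤+*1/[1+n] : (∀ n → p ≤ q + r * 1/[1+ n ]) → p ≤ q
≤-from-≤+*1/[1+n] {p} {q} {r} p≤q+r/[1+n] with p ≤? q
... | yes p≤q = p≤q
... | no  p≰q = ⊥-elim (<-irrefl refl p<p)
  where
  open ≤-Reasoning
  0<p-q : 0ℚ < p - q
  0<p-q = subst (_< p - q) (+-inverseʳ q) (+-monoˡ-< (- q) (≰⇒> p≰q))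
  N = proj₁ (eventually-*1/[1+n]< 0<p-q r)
  p<p : p < p
  p<p = begin-strict
    p                     ≤⟨ p≤q+r/[1+n] N ⟩
    q + r * 1/[1+ N ]     <⟨ +-monoʳ-< q (proj₂ (eventually-*1/[1+n]< 0<p-q r) N ℕ.≤-refl) ⟩
    q + (p - q)           ≡⟨ solve 2 (λ p q → q :+ (p :- q) := p) refl p q ⟩
    p                     ∎

module _ {G G′ : ℚ → ℚ} (DG : Differentiable G G′) {B : ℚ}
         (∣G′∣≤B : ∀ {x} → 0ℚ ≤ x → x ≤ 1ℚ → ∣ G′ x ∣ ≤ B) where

  step-bound : ∀ {x y} → 0ℚ ≤ x → x ≤ y → y ≤ 1ℚ →
               ∣ G y - G x ∣ ≤ B * (y - x) + C DG * ((y - x) * (y - x))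
  step-bound {x} {y} 0≤x x≤y y≤1 = subst₂ (λ u v → ∣ u ∣ ≤ v) split collect
    (∣p+q∣≤r+s (taylor DG 0≤x x≤y y≤1)
      (∣p*q∣≤r*s (≤-reflexive (0≤p⇒∣p∣≡p (p≤q⇒0≤q-p x≤y))) (∣G′∣≤B 0≤x (≤-trans x≤y y≤1))))
    where
    split : G y - G x - (y - x) * G′ x + (y - x) * G′ x ≡ G y - G x
    split = solve 4 (λ Gy Gx d G′x → Gy :- Gx :- d :* G′x :+ d :* G′x := Gy :- Gx) refl (G y) (G x) (y - x) (G′ x)
    collect : C DG * ((y - x) * (y - x)) + (y - x) * B ≡ B * (y - x) + C DG * ((y - x) * (y - x))
    collect = solve 3 (λ C d B → C :* (d :* d) :+ d :* B := B :* d :+ C :* (d :* d)) refl (C DG) (y - x) B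

  grid-bound : ∀ k i → i ℕ.≤ suc k →
    ∣ G (fromℕ i * 1/[1+ k ]) - G 0ℚ ∣ ≤ fromℕ i * (B * 1/[1+ k ] + C DG * (1/[1+ k ] * 1/[1+ k ]))
  grid-bound k zero _
    rewrite *-zeroˡ 1/[1+ k ] | +-inverseʳ (G 0ℚ) | *-zeroˡ (B * 1/[1+ k ] + C DG * (1/[1+ k ] * 1/[1+ k ])) = ≤-refl
  grid-bound k (suc i) i<1+k = subst₂ (λ u v → ∣ u ∣ ≤ v) split collect
    (∣p+q∣≤r+s (subst (λ d → ∣ G y - G x ∣ ≤ B * d + C DG * (d * d)) y-x≡h (step-bound 0≤x x≤y y≤1))
               (grid-bound k i (ℕ.<⇒≤ i<1+k)))
    where
    h = 1/[1+ k ]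
    0≤h = <⇒≤ (1/[1+n]-pos k)
    x = fromℕ i * h
    y = fromℕ (suc i) * h
    y-x≡h : y - x ≡ h
    y-x≡h = solve 2 (λ i h → (con 1ℚ :+ i) :* h :- i :* h := h) refl (fromℕ i) h
    0≤x : 0ℚ ≤ x
    0≤x = 0≤p*q (fromℕ-nonNeg i) 0≤h
    x≤y : x ≤ y
    x≤y = *-monoʳ-≤-nonNeg h {{nonNegative 0≤h}} (fromℕ-mono-≤ (ℕ.n≤1+n i))
    y≤1 : y ≤ 1ℚ
    y≤1 = subst (y ≤_) ([1+n]*1/[1+n]≡1 k) (*-monoʳ-≤-nonNeg h {{nonNegative 0≤h}} (fromℕ-mono-≤ i<1+k))
    split : G y - G x + (G x - G 0ℚ) ≡ G y - G 0ℚ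
    split = solve 3 (λ a b c → a :- b :+ (b :- c) := a :- c) refl (G y) (G x) (G 0ℚ)
    collect : B * h + C DG * (h * h) + fromℕ i * (B * h + C DG * (h * h)) ≡ fromℕ (suc i) * (B * h + C DG * (h * h))
    collect = solve 2 (λ e i → e :+ i :* e := (con 1ℚ :+ i) :* e) refl (B * h + C DG * (h * h)) (fromℕ i)

  mean-value-inequality : ∣ G 1ℚ - G 0ℚ ∣ ≤ B
  mean-value-inequality = ≤-from-≤+*1/[1+n] {r = C DG} mesh-bound
    where
    mesh-bound : ∀ k → ∣ G 1ℚ - G 0ℚ ∣ ≤ B + C DG * 1/[1+ k ]
    mesh-bound k = subst₂ (λ u v → ∣ G u - G 0ℚ ∣ ≤ v)
      ([1+n]*1/[1+n]≡1 k) (collapse {fromℕ (suc k)} {1/[1+ k ]} ([1+n]*1/[1+n]≡1 k))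
      (grid-bound k (suc k) ℕ.≤-refl)
      where
      collapse : ∀ {n h} → n * h ≡ 1ℚ → n * (B * h + C DG * (h * h)) ≡ B + C DG * h
      collapse {n} {h} n*h≡1 = begin
        n * (B * h + C DG * (h * h))
          ≡⟨ solve 4 (λ n h B C → n :* (B :* h :+ C :* (h :* h)) := (n :* h) :* (B :+ C :* h)) refl n h B (C DG) ⟩
        (n * h) * (B + C DG * h)            ≡⟨ cong (_* (B + C DG * h)) n*h≡1 ⟩
        1ℚ * (B + C DG * h)                 ≡⟨ *-identityˡ _ ⟩
        B + C DG * h                        ∎
        where open ≡-Reasoning

⟦_⟧₁ : Polynomial 1 → ℚ → ℚ
⟦ p ⟧₁ x = ⟦ p ⟧ (x ∷ [])

∂ : Polynomial 1 → Polynomial 1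
∂ (op [+] p q) = ∂ p :+ ∂ q
∂ (op [*] p q) = ∂ p :* q :+ p :* ∂ q
∂ (con c)      = con 0ℚ
∂ (var zero)   = con 1ℚ
∂ (p :^ zero)  = con 0ℚ
∂ (p :^ suc n) = con (fromℕ (suc n)) :* p :^ n :* ∂ p
∂ (:- p)       = :- ∂ p

polynomial-diff : ∀ p → Differentiable ⟦ p ⟧₁ ⟦ ∂ p ⟧₁
polynomial-diff (op [+] p q) = +-diff (polynomial-diff p) (polynomial-diff q)
polynomial-diff (op [*] p q) = *-diff (polynomial-diff p) (polynomial-diff q)
polynomial-diff (con c)      = const-diff c
polynomial-diff (var zero)   = id-diff
polynomial-diff (p :^ zero)  = const-diff 1ℚ
polynomial-diff (p :^ suc n) = ^-diff (polynomial-diff p) n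
polynomial-diff (:- p)       = -‿diff (polynomial-diff p)

X : Polynomial 1
X = var zero

bernstein : List (ℕ × ℕ × ℕ) → Polynomial 1
bernstein []                = con 0ℚ
bernstein ((c , i , j) ∷ L) = con (fromℕ c) :* X :^ i :* (con 1ℚ :- X) :^ j :+ bernstein L

bernstein-nonNeg : ∀ L {t} → 0ℚ ≤ t → t ≤ 1ℚ → 0ℚ ≤ ⟦ bernstein L ⟧₁ t
bernstein-nonNeg []                0≤t t≤1 = ≤-refl
bernstein-nonNeg ((c , i , j) ∷ L) 0≤t t≤1 = +-mono-≤
  (0≤p*q (0≤p*q (fromℕ-nonNeg c) (^-nonNeg i 0≤t)) (^-nonNeg j (p≤q⇒0≤q-p t≤1)))
  (bernstein-nonNeg L 0≤t t≤1)

≤-by-bernstein : ∀ L {t} → 0ℚ ≤ t → t ≤ 1ℚ → q - p ≡ ⟦ bernstein L ⟧₁ t → p ≤ q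
≤-by-bernstein L 0≤t t≤1 q-p≡B = 0≤q-p⇒p≤q (subst (0ℚ ≤_) (sym q-p≡B) (bernstein-nonNeg L 0≤t t≤1))

1-_/9 : Polynomial 1 → Polynomial 1
1- Q /9 = con 1ℚ :- con (+ 1 / 9) :* Q

module _ (Q : Polynomial 1) (t : ℚ) where

  1-[1-Q/9]≡Q/9 : 1ℚ - ⟦ 1- Q /9 ⟧₁ t ≡ ⟦ Q ⟧₁ t * (+ 1 / 9)
  1-[1-Q/9]≡Q/9 = solve 1 (λ q → con 1ℚ :- (con 1ℚ :- con (+ 1 / 9) :* q) := q :* con (+ 1 / 9)) refl (⟦ Q ⟧₁ t)

  ∂[1-Q/9]≡-∂Q/9 : ⟦ ∂ (1- Q /9) ⟧₁ t ≡ - (⟦ ∂ Q ⟧₁ t * (+ 1 / 9))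
  ∂[1-Q/9]≡-∂Q/9 = solve 2 (λ q q′ → con 0ℚ :+ :- (con 0ℚ :* q :+ con (+ 1 / 9) :* q′) := :- (q′ :* con (+ 1 / 9)))
                     refl (⟦ Q ⟧₁ t) (⟦ ∂ Q ⟧₁ t)

  bounds-1-Q/9 : + 4 / 1 ≤ ⟦ Q ⟧₁ t → ⟦ Q ⟧₁ t ≤ + 9 / 1 →
                 0ℚ ≤ ⟦ 1- Q /9 ⟧₁ t × ⟦ 1- Q /9 ⟧₁ t ≤ + 5 / 9
  bounds-1-Q/9 4≤Q Q≤9 =
      subst (0ℚ ≤_) (solve 1 (λ q → (con (+ 9 / 1) :- q) :* con (+ 1 / 9) := con 1ℚ :- con (+ 1 / 9) :* q) refl (⟦ Q ⟧₁ t))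
        (0≤p*q (p≤q⇒0≤q-p Q≤9) (≤ᵇ⇒≤ _))
    , 0≤q-p⇒p≤q (subst (0ℚ ≤_)
        (solve 1 (λ q → (q :- con (+ 4 / 1)) :* con (+ 1 / 9) := con (+ 5 / 9) :- (con 1ℚ :- con (+ 1 / 9) :* q))
          refl (⟦ Q ⟧₁ t))
        (0≤p*q (p≤q⇒0≤q-p 4≤Q) (≤ᵇ⇒≤ _)))

N D : Polynomial 1
N = (con (+ 3 / 1) :- X :^ 2) :^ 2
D = (X :^ 2 :- con (+ 3 / 1) :* X :+ con (+ 3 / 1)) :* (X :^ 2 :+ con (+ 3 / 1))

a b : Polynomial 1
a = 1- N /9
b = 1- D /9

a[0]≡b[0] : ⟦ a ⟧₁ 0ℚ ≡ ⟦ b ⟧₁ 0ℚ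
a[0]≡b[0] = refl

a[1]≡b[1] : ⟦ a ⟧₁ 1ℚ ≡ ⟦ b ⟧₁ 1ℚ
a[1]≡b[1] = refl

w : ℚ → ℚ
w t = + 1 / 729 * t ^ 12

module _ {t : ℚ} (0≤t : 0ℚ ≤ t) (t≤1 : t ≤ 1ℚ) where

  4≤N : + 4 / 1 ≤ ⟦ N ⟧₁ t
  4≤N = ≤-by-bernstein L 0≤t t≤1 (solve 1 (λ _ → N :- con (+ 4 / 1) := bernstein L) refl t)
    where L = (4 , 0 , 1) ∷ (4 , 1 , 1) ∷ (1 , 0 , 2) ∷ (2 , 1 , 2) ∷ (1 , 2 , 2) ∷ []

  N≤9 : ⟦ N ⟧₁ t ≤ + 9 / 1
  N≤9 = ≤-by-bernstein L 0≤t t≤1 (solve 1 (λ _ → con (+ 9 / 1) :- N := bernstein L) refl t)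
    where L = (5 , 2 , 0) ∷ (1 , 2 , 1) ∷ (1 , 3 , 1) ∷ []

  4≤D : + 4 / 1 ≤ ⟦ D ⟧₁ t
  4≤D = ≤-by-bernstein L 0≤t t≤1 (solve 1 (λ _ → D :- con (+ 4 / 1) := bernstein L) refl t)
    where L = (5 , 0 , 2) ∷ (1 , 1 , 2) ∷ (1 , 2 , 2) ∷ (2 , 2 , 1) ∷ []

  D≤9 : ⟦ D ⟧₁ t ≤ + 9 / 1
  D≤9 = ≤-by-bernstein L 0≤t t≤1 (solve 1 (λ _ → con (+ 9 / 1) :- D := bernstein L) refl t)
    where L = (2 , 1 , 0) ∷ (7 , 1 , 1) ∷ (1 , 2 , 1) ∷ (3 , 3 , 0) ∷ (1 , 3 , 1) ∷ []

  ∣wⁿ∣≤½ⁿ : ∀ n → ∣ w t ^ n ∣ ≤ ½ ^ n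
  ∣wⁿ∣≤½ⁿ n = ∣p^n∣≤½^n n (0≤p*q {p = + 1 / 729} (≤ᵇ⇒≤ _) (^-nonNeg 12 0≤t))
    (≤-trans (*-monoˡ-≤-nonNeg (+ 1 / 729) t¹²≤1) (≤ᵇ⇒≤ {p = + 1 / 729 * 1ℚ} {q = ½} _))
    where
    t¹²≤1 : t ^ 12 ≤ 1ℚ
    t¹²≤1 = subst (t ^ 12 ≤_) (1^n≡1 12) (^-mono-≤ 12 0≤t t≤1)

  ∣[1-Q/9]^[n+n]-wⁿ∣≤½ⁿ+½ⁿ : ∀ Q n → + 4 / 1 ≤ ⟦ Q ⟧₁ t → ⟦ Q ⟧₁ t ≤ + 9 / 1 →
                             ∣ ⟦ 1- Q /9 ⟧₁ t ^ (n ℕ.+ n) - w t ^ n ∣ ≤ ½ ^ n + ½ ^ n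
  ∣[1-Q/9]^[n+n]-wⁿ∣≤½ⁿ+½ⁿ Q n 4≤Q Q≤9 = ∣p-q∣≤r+s {p = ⟦ 1- Q /9 ⟧₁ t ^ (n ℕ.+ n)}
    (∣p^[n+n]∣≤½^n n (proj₁ (bounds-1-Q/9 Q t 4≤Q Q≤9)) (proj₂ (bounds-1-Q/9 Q t 4≤Q Q≤9))) (∣wⁿ∣≤½ⁿ n)

sparse : List (ℤ × ℕ) → Polynomial 1
sparse []             = con 0ℚ
sparse ((c , j) ∷ cs) = con (c / 1) :* X :^ j :+ sparse cs

⟦sparse⟧₁ : ∀ cs t → ⟦ sparse cs ⟧₁ t ≡ ∑ᴸ (λ (c , j) → c / 1 * t ^ j) cs
⟦sparse⟧₁ []             t = refl
⟦sparse⟧₁ ((c , j) ∷ cs) t = cong (_+_ (c / 1 * t ^ j)) (⟦sparse⟧₁ cs t)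

coefficients : List (ℤ × ℕ)
coefficients = (+ 243 , 0) ∷ (ℤ.- (+ 405) , 1) ∷ (ℤ.- (+ 81) , 3) ∷ (ℤ.- (+ 27) , 4) ∷ (ℤ.- (+ 72) , 5)
             ∷ (ℤ.- (+ 9) , 6) ∷ (ℤ.- (+ 9) , 7) ∷ (ℤ.- (+ 5) , 9) ∷ (+ 1 , 10) ∷ []

P : Polynomial 1
P = sparse coefficients

P*N*D : ∀ t → ⟦ P ⟧₁ t * ⟦ N ⟧₁ t * ⟦ D ⟧₁ t
            ≡ + 243 / 1 * (⟦ ∂ N ⟧₁ t * ⟦ D ⟧₁ t - ⟦ N ⟧₁ t * ⟦ ∂ D ⟧₁ t) * (1ℚ - w t)
P*N*D = solve 1 (λ t → P :* N :* D := con (+ 243 / 1) :* (∂ N :* D :- N :* ∂ D) :* (con 1ℚ :- con (+ 1 / 729) :* t :^ 12)) refl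

monomial-diff : ∀ c m → Differentiable (λ t → c / suc m * t ^ suc m) (λ t → c / 1 * t ^ m)
monomial-diff c m = diff-cong (scale-diff (c / suc m) (^-diff id-diff m)) (λ _ → refl) λ t → begin
  c / suc m * (fromℕ (suc m) * t ^ m * 1ℚ)  ≡⟨ solve 3 (λ q k tᵐ → q :* (k :* tᵐ :* con 1ℚ) := q :* k :* tᵐ)
                                                 refl (c / suc m) (fromℕ (suc m)) (t ^ m) ⟩
  c / suc m * fromℕ (suc m) * t ^ m         ≡⟨ cong (_* t ^ m) (c/[1+n]*[1+n]≡c c m) ⟩
  c / 1 * t ^ m                             ∎
  where open ≡-Reasoning

antiderivative : ℕ → ℚ → ℚ
antiderivative k t = ∑ᴸ (λ (c , j) → frac c k j * t ^ suc (12 ℕ.* k ℕ.+ j)) coefficients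

antiderivative-diff : ∀ k → Differentiable (antiderivative k) (λ t → t ^ (12 ℕ.* k) * ⟦ P ⟧₁ t)
antiderivative-diff k = diff-cong
  (∑ᴸ-diff {F = λ (c , j) t → frac c k j * t ^ suc (12 ℕ.* k ℕ.+ j)}
           (λ (c , j) → monomial-diff c (12 ℕ.* k ℕ.+ j)) coefficients)
  (λ _ → refl) λ t → begin
    ∑ᴸ (λ (c , j) → c / 1 * t ^ (12 ℕ.* k ℕ.+ j)) coefficients
      ≡⟨ ∑ᴸ-cong coefficients (λ (c , j) → trans (cong (c / 1 *_) (^-homo-* t (12 ℕ.* k) j))
             (solve 3 (λ c u v → c :* (u :* v) := u :* (c :* v)) refl (c / 1) (t ^ (12 ℕ.* k)) (t ^ j))) ⟩
    ∑ᴸ (λ (c , j) → t ^ (12 ℕ.* k) * (c / 1 * t ^ j)) coefficients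
      ≡⟨ ∑ᴸ-*-distribˡ (t ^ (12 ℕ.* k)) (λ (c , j) → c / 1 * t ^ j) coefficients ⟨
    t ^ (12 ℕ.* k) * ∑ᴸ (λ (c , j) → c / 1 * t ^ j) coefficients
      ≡⟨ cong (t ^ (12 ℕ.* k) *_) (⟦sparse⟧₁ coefficients t) ⟨
    t ^ (12 ℕ.* k) * ⟦ P ⟧₁ t
      ∎
  where open ≡-Reasoning

inv729^≡ : ∀ k → inv729^ k ≡ (+ 1 / 729) ^ k
inv729^≡ zero    = refl
inv729^≡ (suc k) = trans (*-comm (inv729^ k) (+ 1 / 729)) (cong (+ 1 / 729 *_) (inv729^≡ k))

w^k≡ : ∀ t k → w t ^ k ≡ inv729^ k * t ^ (12 ℕ.* k)
w^k≡ t k = begin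
  (+ 1 / 729 * t ^ 12) ^ k        ≡⟨ ^-distrib-* (+ 1 / 729) (t ^ 12) k ⟩
  (+ 1 / 729) ^ k * (t ^ 12) ^ k  ≡⟨ cong₂ _*_ (inv729^≡ k) (sym (^-assocʳ t 12 k)) ⟨
  inv729^ k * t ^ (12 ℕ.* k)      ∎
  where open ≡-Reasoning

A : ℕ → ℚ → ℚ
A n t = ∑[ k < n ] inv729^ k * antiderivative k t

A-diff : ∀ n → Differentiable (A n) (λ t → ⟦ P ⟧₁ t * (∑[ k < n ] w t ^ k))
A-diff n = diff-cong (∑-diff (λ k → scale-diff (inv729^ k) (antiderivative-diff k)) n) (λ _ → refl) λ t → begin
  ∑[ k < n ] inv729^ k * (t ^ (12 ℕ.* k) * ⟦ P ⟧₁ t)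
    ≡⟨ ∑-cong n (λ k → trans (solve 3 (λ r u p → r :* (u :* p) := p :* (r :* u))
                                       refl (inv729^ k) (t ^ (12 ℕ.* k)) (⟦ P ⟧₁ t))
                             (cong (⟦ P ⟧₁ t *_) (sym (w^k≡ t k)))) ⟩
  ∑[ k < n ] ⟦ P ⟧₁ t * w t ^ k
    ≡⟨ ∑-*-distribˡ (⟦ P ⟧₁ t) (w t ^_) n ⟨
  ⟦ P ⟧₁ t * (∑[ k < n ] w t ^ k)
    ∎
  where open ≡-Reasoning

A[0]≡0 : ∀ n → A n 0ℚ ≡ 0ℚ
A[0]≡0 n = ∑-zero n λ k → trans (cong (inv729^ k *_) (∑ᴸ-zero coefficients λ (c , j) →
  trans (cong (frac c k j *_) (*-zeroˡ (0ℚ ^ (12 ℕ.* k ℕ.+ j)))) (*-zeroʳ (frac c k j)))) (*-zeroʳ (inv729^ k))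

partialSum≡∑term : ∀ n → partialSum n ≡ ∑ n term
partialSum≡∑term zero    = refl
partialSum≡∑term (suc n) = cong (_+ term n) (partialSum≡∑term n)

term≡ : ∀ k → term k ≡ inv729^ k * ∑ᴸ (λ (c , j) → frac c k j) coefficients
term≡ k = cong (inv729^ k *_) (foldl-+ (λ (c , j) → frac c k j) (+ 243 , 0) (drop 1 coefficients))

A[1]≡partialSum : ∀ n → A n 1ℚ ≡ partialSum n
A[1]≡partialSum n = sym (trans (partialSum≡∑term n) (∑-cong n λ k → trans (term≡ k)
  (cong (inv729^ k *_) (∑ᴸ-cong coefficients λ (c , j) → sym (trans
    (cong (frac c k j *_) (1^n≡1 (suc (12 ℕ.* k ℕ.+ j)))) (*-identityʳ (frac c k j)))))))

logSeries : ℕ → ℚ → ℚ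
logSeries M u = ∑[ j < M ] 1/[1+ j ] * u ^ suc j

logSeries-diff : Differentiable f f′ → ∀ M →
                 Differentiable (λ x → logSeries M (f x)) (λ x → (∑[ j < M ] f x ^ j) * f′ x)
logSeries-diff {f} {f′} Df M = diff-cong
  (∑-diff (λ j → scale-diff 1/[1+ j ] (^-diff Df j)) M) (λ _ → refl)
  (λ x → trans (∑-cong M (λ j → cancel j (f x ^ j) (f′ x))) (sym (∑-*-distribʳ (f′ x) (f x ^_) M)))
  where
  cancel : ∀ j u v → 1/[1+ j ] * (fromℕ (suc j) * u * v) ≡ u * v
  cancel j u v = begin
    1/[1+ j ] * (fromℕ (suc j) * u * v)     ≡⟨ solve 4 (λ h k u v → h :* (k :* u :* v) := (k :* h) :* (u :* v))
                                                   refl 1/[1+ j ] (fromℕ (suc j)) u v ⟩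
    fromℕ (suc j) * 1/[1+ j ] * (u * v)     ≡⟨ cong (_* (u * v)) ([1+n]*1/[1+n]≡1 j) ⟩
    1ℚ * (u * v)                            ≡⟨ *-identityˡ (u * v) ⟩
    u * v                                   ∎
    where open ≡-Reasoning

log-derivative : ∀ {u u′ v v′ c} M → 1ℚ - u ≡ v * c → u′ ≡ - (v′ * c) →
                 (∑[ j < M ] u ^ j) * u′ * v ≡ - (v′ * (1ℚ - u ^ M))
log-derivative {u} {u′} {v} {v′} {c} M 1-u≡v*c u′≡-v′*c = begin
  Y * u′ * v                ≡⟨ cong (λ z → Y * z * v) u′≡-v′*c ⟩
  Y * - (v′ * c) * v        ≡⟨ solve 4 (λ Y v v′ c → Y :* :- (v′ :* c) :* v := :- (v′ :* (v :* c :* Y))) refl Y v v′ c ⟩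
  - (v′ * (v * c * Y))      ≡⟨ cong (λ z → - (v′ * (z * Y))) 1-u≡v*c ⟨
  - (v′ * ((1ℚ - u) * Y))   ≡⟨ cong (λ z → - (v′ * z)) (geometric u M) ⟩
  - (v′ * (1ℚ - u ^ M))     ∎
  where
  open ≡-Reasoning
  Y = ∑[ j < M ] u ^ j

G : ℕ → ℚ → ℚ
G n t = A n t - + 243 / 1 * (logSeries (n ℕ.+ n) (⟦ b ⟧₁ t) - logSeries (n ℕ.+ n) (⟦ a ⟧₁ t))

G′ : ℕ → ℚ → ℚ
G′ n t = ⟦ P ⟧₁ t * (∑[ k < n ] w t ^ k)
       - + 243 / 1 * ((∑[ j < n ℕ.+ n ] ⟦ b ⟧₁ t ^ j) * ⟦ ∂ b ⟧₁ t
                    - (∑[ j < n ℕ.+ n ] ⟦ a ⟧₁ t ^ j) * ⟦ ∂ a ⟧₁ t)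

G-diff : ∀ n → Differentiable (G n) (G′ n)
G-diff n = +-diff (A-diff n) (-‿diff (scale-diff (+ 243 / 1)
  (+-diff (logSeries-diff (polynomial-diff b) (n ℕ.+ n)) (-‿diff (logSeries-diff (polynomial-diff a) (n ℕ.+ n))))))

G≡A : ∀ n {t} → ⟦ a ⟧₁ t ≡ ⟦ b ⟧₁ t → G n t ≡ A n t
G≡A n {t} a≡b = begin
  A n t - + 243 / 1 * (logSeries (n ℕ.+ n) (⟦ b ⟧₁ t) - logSeries (n ℕ.+ n) (⟦ a ⟧₁ t))
    ≡⟨ cong (λ u → A n t - + 243 / 1 * (logSeries (n ℕ.+ n) (⟦ b ⟧₁ t) - logSeries (n ℕ.+ n) u)) a≡b ⟩
  A n t - + 243 / 1 * (logSeries (n ℕ.+ n) (⟦ b ⟧₁ t) - logSeries (n ℕ.+ n) (⟦ b ⟧₁ t))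
    ≡⟨ solve 2 (λ A L → A :- con (+ 243 / 1) :* (L :- L) := A) refl (A n t) (logSeries (n ℕ.+ n) (⟦ b ⟧₁ t)) ⟩
  A n t ∎
  where open ≡-Reasoning

G[1]-G[0]≡partialSum : ∀ n → G n 1ℚ - G n 0ℚ ≡ partialSum n
G[1]-G[0]≡partialSum n = begin
  G n 1ℚ - G n 0ℚ       ≡⟨ cong₂ _-_ (G≡A n {1ℚ} a[1]≡b[1]) (G≡A n {0ℚ} a[0]≡b[0]) ⟩
  A n 1ℚ - A n 0ℚ       ≡⟨ cong₂ _-_ (A[1]≡partialSum n) (A[0]≡0 n) ⟩
  partialSum n - 0ℚ     ≡⟨ +-identityʳ (partialSum n) ⟩
  partialSum n          ∎
  where open ≡-Reasoning

G′*N*D≡ : ∀ n t → G′ n t * ⟦ N ⟧₁ t * ⟦ D ⟧₁ t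
  ≡ + 243 / 1 * (⟦ ∂ N ⟧₁ t * ⟦ D ⟧₁ t * (⟦ a ⟧₁ t ^ (n ℕ.+ n) - w t ^ n)
               - ⟦ N ⟧₁ t * ⟦ ∂ D ⟧₁ t * (⟦ b ⟧₁ t ^ (n ℕ.+ n) - w t ^ n))
G′*N*D≡ n t = begin
  (P₀ * Σw - c * (Σb * b′ - Σa * a′)) * N₀ * D₀
    ≡⟨ solve 9 (λ P₀ Σw c Σb b′ Σa a′ N₀ D₀ →
         (P₀ :* Σw :- c :* (Σb :* b′ :- Σa :* a′)) :* N₀ :* D₀
         := P₀ :* N₀ :* D₀ :* Σw :- c :* (Σb :* b′ :* D₀ :* N₀ :- Σa :* a′ :* N₀ :* D₀))
       refl P₀ Σw c Σb b′ Σa a′ N₀ D₀ ⟩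
  P₀ * N₀ * D₀ * Σw - c * (Σb * b′ * D₀ * N₀ - Σa * a′ * N₀ * D₀)
    ≡⟨ cong₂ (λ u v → u * Σw - c * v) (P*N*D t)
         (cong₂ (λ u v → u * N₀ - v * D₀)
           (log-derivative {u′ = b′} {v′ = D₁} m (1-[1-Q/9]≡Q/9 D t) (∂[1-Q/9]≡-∂Q/9 D t))
           (log-derivative {u′ = a′} {v′ = N₁} m (1-[1-Q/9]≡Q/9 N t) (∂[1-Q/9]≡-∂Q/9 N t))) ⟩
  c * (N₁ * D₀ - N₀ * D₁) * (1ℚ - w t) * Σw - c * (- (D₁ * (1ℚ - bᴹ)) * N₀ - - (N₁ * (1ℚ - aᴹ)) * D₀)
    ≡⟨ cong (_- c * (- (D₁ * (1ℚ - bᴹ)) * N₀ - - (N₁ * (1ℚ - aᴹ)) * D₀))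
         (trans (*-assoc (c * (N₁ * D₀ - N₀ * D₁)) (1ℚ - w t) Σw)
                (cong (c * (N₁ * D₀ - N₀ * D₁) *_) (geometric (w t) n))) ⟩
  c * (N₁ * D₀ - N₀ * D₁) * (1ℚ - wⁿ) - c * (- (D₁ * (1ℚ - bᴹ)) * N₀ - - (N₁ * (1ℚ - aᴹ)) * D₀)
    ≡⟨ solve 8 (λ c N₀ D₀ N₁ D₁ wⁿ aᴹ bᴹ →
         c :* (N₁ :* D₀ :- N₀ :* D₁) :* (con 1ℚ :- wⁿ)
           :- c :* (:- (D₁ :* (con 1ℚ :- bᴹ)) :* N₀ :- :- (N₁ :* (con 1ℚ :- aᴹ)) :* D₀)
         := c :* (N₁ :* D₀ :* (aᴹ :- wⁿ) :- N₀ :* D₁ :* (bᴹ :- wⁿ)))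
       refl c N₀ D₀ N₁ D₁ wⁿ aᴹ bᴹ ⟩
  c * (N₁ * D₀ * (aᴹ - wⁿ) - N₀ * D₁ * (bᴹ - wⁿ))
    ∎
  where
  open ≡-Reasoning
  m = n ℕ.+ n
  c = + 243 / 1
  P₀ = ⟦ P ⟧₁ t
  N₀ = ⟦ N ⟧₁ t
  D₀ = ⟦ D ⟧₁ t
  N₁ = ⟦ ∂ N ⟧₁ t
  D₁ = ⟦ ∂ D ⟧₁ t
  a′ = ⟦ ∂ a ⟧₁ t
  b′ = ⟦ ∂ b ⟧₁ t
  Σw = ∑[ k < n ] w t ^ k
  Σa = ∑[ j < m ] ⟦ a ⟧₁ t ^ j
  Σb = ∑[ j < m ] ⟦ b ⟧₁ t ^ j
  wⁿ = w t ^ n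
  aᴹ = ⟦ a ⟧₁ t ^ m
  bᴹ = ⟦ b ⟧₁ t ^ m

K : ℚ
K = + 486 / 1 * (M′ (polynomial-diff N) * M (polynomial-diff D) + M (polynomial-diff N) * M′ (polynomial-diff D))

K-nonNeg : 0ℚ ≤ K
K-nonNeg = 0≤p*q {p = + 486 / 1} (≤ᵇ⇒≤ _) (+-mono-≤
  (0≤p*q (M′-nonNeg (polynomial-diff N)) (M-nonNeg (polynomial-diff D)))
  (0≤p*q (M-nonNeg (polynomial-diff N)) (M′-nonNeg (polynomial-diff D))))

∣G′∣≤K½ⁿ : ∀ n {t} → 0ℚ ≤ t → t ≤ 1ℚ → ∣ G′ n t ∣ ≤ K * ½ ^ n
∣G′∣≤K½ⁿ n {t} 0≤t t≤1 = begin
  ∣ G′ n t ∣                                   ≤⟨ ∣p∣≤∣p*q*r∣ (≤-trans 1≤4 (4≤N 0≤t t≤1))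
                                                                (≤-trans 1≤4 (4≤D 0≤t t≤1)) ⟩
  ∣ G′ n t * ⟦ N ⟧₁ t * ⟦ D ⟧₁ t ∣             ≡⟨ cong ∣_∣ (G′*N*D≡ n t) ⟩
  ∣ c * (N′ * D₀ * eₐ - N₀ * D′ * e_b) ∣
    ≤⟨ ∣p*q∣≤r*s {p = c} ≤-refl (∣p-q∣≤r+s {p = N′ * D₀ * eₐ}
         (∣p*q∣≤r*s {p = N′ * D₀} (∣p*q∣≤r*s {p = N′} (bound′ DN 0≤t t≤1) (bound DD 0≤t t≤1))
           (∣[1-Q/9]^[n+n]-wⁿ∣≤½ⁿ+½ⁿ 0≤t t≤1 N n (4≤N 0≤t t≤1) (N≤9 0≤t t≤1)))
         (∣p*q∣≤r*s {p = N₀ * D′} (∣p*q∣≤r*s {p = N₀} (bound DN 0≤t t≤1) (bound′ DD 0≤t t≤1))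
           (∣[1-Q/9]^[n+n]-wⁿ∣≤½ⁿ+½ⁿ 0≤t t≤1 D n (4≤D 0≤t t≤1) (D≤9 0≤t t≤1)))) ⟩
  c * (M′ DN * M DD * (½ ^ n + ½ ^ n) + M DN * M′ DD * (½ ^ n + ½ ^ n))
    ≡⟨ solve 5 (λ α β γ δ r → con (+ 243 / 1) :* (α :* β :* (r :+ r) :+ γ :* δ :* (r :+ r))
                            := con (+ 486 / 1) :* (α :* β :+ γ :* δ) :* r)
             refl (M′ DN) (M DD) (M DN) (M′ DD) (½ ^ n) ⟩
  K * ½ ^ n                                    ∎
  where
  open ≤-Reasoning
  c = + 243 / 1
  N₀ = ⟦ N ⟧₁ t
  D₀ = ⟦ D ⟧₁ t
  N′ = ⟦ ∂ N ⟧₁ t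
  D′ = ⟦ ∂ D ⟧₁ t
  eₐ = ⟦ a ⟧₁ t ^ (n ℕ.+ n) - w t ^ n
  e_b = ⟦ b ⟧₁ t ^ (n ℕ.+ n) - w t ^ n
  DN = polynomial-diff N
  DD = polynomial-diff D
  1≤4 : 1ℚ ≤ + 4 / 1
  1≤4 = ≤ᵇ⇒≤ _

∣partialSum∣≤K½ⁿ : ∀ n → ∣ partialSum n ∣ ≤ K * ½ ^ n
∣partialSum∣≤K½ⁿ n = subst (λ v → ∣ v ∣ ≤ K * ½ ^ n) (G[1]-G[0]≡partialSum n)
  (mean-value-inequality (G-diff n) (∣G′∣≤K½ⁿ n))

mainTheorem7 : (ε : ℚ) → 0ℚ < ε → ∃[ N ] ((n : ℕ) → n ≥ N → ∣ partialSum n ∣ < ε)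
mainTheorem7 ε 0<ε = N₀ , λ n n≥N₀ → begin-strict
  ∣ partialSum n ∣  ≤⟨ ∣partialSum∣≤K½ⁿ n ⟩
  K * ½ ^ n         ≤⟨ *-mono-≤-nonNeg K-nonNeg (^-nonNeg n 0≤½) ≤-refl (½^n≤1/[1+n] n) ⟩
  K * 1/[1+ n ]     <⟨ proj₂ (eventually-*1/[1+n]< 0<ε K) n n≥N₀ ⟩
  ε                 ∎
  where
  open ≤-Reasoning
  N₀ = proj₁ (eventually-*1/[1+n]< 0<ε K)
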